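{- Let $n$ and $k$ be positive integers with $k\geq 2$ and $n\geq\max\{k+4,2k\}$. Then $$\mathrm{tw}(\overline{J(n,k)})\geq \binom{n}{k}-n+k-2.$$
   Context: $\overline{J(n,k)}$ is the complement of the Johnson graph: its vertices are the $k$-element subsets of $[n]=\{1,\dots,n\}$, with $A\neq B$ adjacent iff $|A\cap B|<k-1$. A tree decomposition of a graph $G$ is a pair $(T,(B_x)_{x\in V(T)})$ with $T$ a tree and each $B_x\subseteq V(G)$, such that for every $v\in V(G)$ the set of nodes $x$ with $v\in B_x$ induces a nonempty connected subtree of $T$, and every edge of $G$ has both endpoints in some $B_x$. Its width is $\max_x|B_x|-1$, and the treewidth $\mathrm{tw}(G)$ is the minimum width over all tree decompositions of $G$. -}

module Defs where

open import Data.Nat using (ℕ; zero; suc; _+_; _∸_; _≤_; _<_; _⊔_)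
open import Data.Fin using (Fin; toℕ) renaming (suc to fsuc)
open import Data.Fin.Subset using (Subset; ∣_∣; _∩_)
open import Data.List using (List; length; foldr; map; allFin)
open import Data.List.Membership.Propositional using (_∈_)
open import Data.List.Relation.Unary.Unique.Propositional using (Unique)
open import Data.Product using (Σ; ∃; ∃-syntax; _×_; _,_)
open import Data.Sum using (_⊎_)
open import Relation.Binary.PropositionalEquality using (_≡_; _≢_)

record Graph : Set₁ where
  field
    V   : Set
    Adj : V → V → Set

-- The complement of the Johnson graph J(n,k):
-- vertices are k-element subsets of [n] (modelled as Fin n),
-- A ≠ B adjacent iff |A ∩ B| < k - 1  (i.e. |A ∩ B| + 1 < k).
JohnsonBar : ℕ → ℕ → Graph
JohnsonBar n k = record
  { V   = Σ (Subset n) (λ A → ∣ A ∣ ≡ k)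
  ; Adj = λ A B → (Σ.proj₁ A ≢ Σ.proj₁ B) × (suc ∣ Σ.proj₁ A ∩ Σ.proj₁ B ∣ < k)
  }
  where open import Data.Product as Σ using ()

-- A finite tree on the node set Fin (suc m), given in rooted form:
-- node 0 is the root and node (suc i) has a parent with smaller index.
-- (Every finite tree is isomorphic to one of this form.)
record Tree : Set where
  field
    m        : ℕ
    parent   : Fin m → Fin (suc m)
    parent<  : (i : Fin m) → toℕ (parent i) ≤ toℕ i

  Node : Set
  Node = Fin (suc m)

  TAdj : Node → Node → Set
  TAdj x y = ∃[ i ] ((x ≡ fsuc i × y ≡ parent i) ⊎ (y ≡ fsuc i × x ≡ parent i))

  data WalkIn (S : Node → Set) : Node → Node → Set where
    here : ∀ {x} → S x → WalkIn S x x
    step : ∀ {x y z} → S x → TAdj x y → WalkIn S y z → WalkIn S x z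

record TreeDecomposition (G : Graph) : Set₁ where
  open Graph G
  field
    tree : Tree
  open Tree tree public
  field
    bag       : Node → List V
    bagUnique : ∀ x → Unique (bag x)
    covers    : ∀ v → ∃[ x ] (v ∈ bag x)
    connected : ∀ v x y → v ∈ bag x → v ∈ bag y → WalkIn (λ z → v ∈ bag z) x y
    edgeCover : ∀ u v → Adj u v → ∃[ x ] (u ∈ bag x × v ∈ bag x)

  maxBagSize : ℕ
  maxBagSize = foldr _⊔_ 0 (map (λ x → length (bag x)) (allFin (suc m)))

  width : ℕ
  width = maxBagSize ∸ 1

twAtLeast : (G : Graph) → ℕ → Set₁
twAtLeast G w = (D : TreeDecomposition G) → w ≤ TreeDecomposition.width D

-- Fix a tree decomposition; for a node x let W_x be the set of k-sets missing from the bag at x. Two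
-- facts about J(n,k) drive the argument. Its cliques have at most max(n - k + 1, k + 1) elements. And if
-- every vertex of X is J-adjacent to every vertex of Y, while X and Y both contain complement-edges, say
-- u u' in X, then all members of X ∪ Y are k-sets between u ∩ u' (of size k - 2) and u ∪ u', so
-- |X| + |Y| ≤ C(4,2) = 6. Hence at every node, |W_x| ≤ n - k + 1 (and the bag is large enough), or W_x
-- contains a connected set of 5 vertices, or a connected set dominating the bag with |W_x| ≤ n - k + 2.
-- Starting at the root, in the second case we step to the child whose subtree holds the 5 vertices; by
-- the second fact, no connected set with an edge then lies wholly outside the current subtree. In the
-- third case, walking towards the dominating set carries the whole bag along until some bag also meets
-- the set, and that bag has one more element.

module Submission where

open import Defs

open import Data.Bool using () renaming (_≟_ to _≟ᵇ_)
open import Data.Empty using (⊥; ⊥-elim)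
open import Data.Fin using (toℕ) renaming (zero to fzero; suc to fsuc)
import Data.Fin.Properties as Fin
open import Data.Fin.Subset using (Subset; Side; inside; outside; ∣_∣; _∩_; _∪_; _⊆_)
  renaming (_∈_ to _∈ₛ_; ⊥ to ∅; ⊤ to full)
open import Data.Fin.Subset.Properties
  using ( p⊆q⇒∣p∣≤∣q∣; drop-∷-⊆; p∩q⊆p; p∩q⊆q; x∈p∩q⁺; x∈p∩q⁻; x∈p∪q⁺; x∈p∪q⁻; ∩-comm; ∩-idem
        ; ∣p∩q∣≤∣p∣; ⊆-antisym; _⊆?_; ⊥⊆; ⊆⊤; ∣⊥∣≡0; ∣⊤∣≡n; ∣p∣≤n )
open import Data.List using (List; []; _∷_; length; map; filter; _++_; foldr)
open import Data.List.Properties using (length-map; length-++; length-removeAt′)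
open import Data.List.Membership.Propositional using (_∈_; _∉_; find; lose)
open import Data.List.Membership.Propositional.Properties using (∈-map⁻; ∈-++⁻; ∈-filter⁻; ∈-allFin)
import Data.List.Membership.DecPropositional as DecMembership
open import Data.List.Relation.Unary.All using (All; []; _∷_)
import Data.List.Relation.Unary.All as All
import Data.List.Relation.Unary.All.Properties as All
import Data.List.Relation.Unary.AllPairs as AllPairs
open import Data.List.Relation.Unary.Any using (here; there; _─_; any?)
open import Data.List.Relation.Unary.Unique.Propositional using (Unique)
import Data.List.Relation.Unary.Unique.Propositional.Properties as Unique
open import Data.Nat using (ℕ; zero; suc; _+_; _*_; _∸_; _≤_; _<_; _⊔_; z≤n; s≤s; _<?_; _≤?_)
open import Data.Nat.Combinatorics using (_C_; nCk+nC[k+1]≡[n+1]C[k+1]; nC1≡n; nCk≡nC[n∸k])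
open import Data.Nat.Properties
open import Data.Nat.Tactic.RingSolver using (solve-∀)
open import Data.Product using (Σ; ∃; ∃₂; _×_; _,_; proj₁; proj₂; swap)
open import Data.Sum using (_⊎_; inj₁; inj₂)
import Data.Sum as Sum
open import Data.Vec using (_∷_; [])
import Data.Vec as Vec
import Data.Vec.Properties as Vec
open import Data.Vec.Base using () renaming (here to hereᵥ)
open import Function using (_∘_)
open import Level using (0ℓ)
open import Relation.Binary using (DecidableEquality)
open import Relation.Binary.PropositionalEquality
open import Relation.Nullary using (¬_; Dec; yes; no; ¬?; _×-dec_)
open import Relation.Nullary.Decidable using (map′; decidable-stable)
open import Relation.Unary using (Pred; Decidable)
open import Relation.Unary.Properties using (∁?)

module _ {A : Set} where

  ∈-─ : ∀ {x y : A} {xs} (x∈xs : x ∈ xs) → y ∈ xs → y ≢ x → y ∈ (xs ─ x∈xs)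
  ∈-─ (here refl) (here refl) y≢x = ⊥-elim (y≢x refl)
  ∈-─ (here refl) (there y∈xs) _ = y∈xs
  ∈-─ (there _) (here refl) _ = here refl
  ∈-─ (there x∈xs) (there y∈xs) y≢x = there (∈-─ x∈xs y∈xs y≢x)

  unique⊆⇒length≤ : ∀ {xs ys : List A} → Unique xs → (∀ {x} → x ∈ xs → x ∈ ys) → length xs ≤ length ys
  unique⊆⇒length≤ {[]} _ _ = z≤n
  unique⊆⇒length≤ {x ∷ xs} {ys} (x∉xs AllPairs.∷ u) xs⊆ys = begin
    suc (length xs)          ≤⟨ s≤s (unique⊆⇒length≤ u xs⊆ys─x) ⟩
    suc (length (ys ─ x∈ys)) ≡⟨ length-removeAt′ ys _ ⟨
    length ys                ∎
    where
    open ≤-Reasoning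
    x∈ys = xs⊆ys (here refl)
    xs⊆ys─x : ∀ {y} → y ∈ xs → y ∈ (ys ─ x∈ys)
    xs⊆ys─x y∈xs = ∈-─ x∈ys (xs⊆ys (there y∈xs)) λ { refl → All.lookup x∉xs y∈xs refl }

  ∈⇒≤foldr-⊔ : ∀ (f : A → ℕ) {x xs} → x ∈ xs → f x ≤ foldr _⊔_ 0 (map f xs)
  ∈⇒≤foldr-⊔ f (here refl) = m≤m⊔n _ _
  ∈⇒≤foldr-⊔ f (there x∈xs) = ≤-trans (∈⇒≤foldr-⊔ f x∈xs) (m≤n⊔m _ _)

  two-members⇒2≤length : ∀ {x y : A} {xs} → x ∈ xs → y ∈ xs → x ≢ y → 2 ≤ length xs
  two-members⇒2≤length (here refl) (here refl) x≢y = ⊥-elim (x≢y refl)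
  two-members⇒2≤length {xs = _ ∷ _ ∷ _} _ _ _ = s≤s (s≤s z≤n)
  two-members⇒2≤length {xs = _ ∷ []} (here refl) (there ()) _
  two-members⇒2≤length {xs = _ ∷ []} (there ()) _ _

  unique-∷ : ∀ {x : A} {xs} → x ∉ xs → Unique xs → Unique (x ∷ xs)
  unique-∷ x∉xs u = All.tabulate (λ y∈xs x≡y → x∉xs (subst (_∈ _) (sym x≡y) y∈xs)) AllPairs.∷ u

  All-absurd⇒≡[] : ∀ {P : Pred A 0ℓ} {xs} → All P xs → (∀ {x} → ¬ P x) → xs ≡ []
  All-absurd⇒≡[] [] _ = refl
  All-absurd⇒≡[] (px ∷ _) ¬p = ⊥-elim (¬p px)

  module _ {P : Pred A 0ℓ} (P? : Decidable P) where

    length-filter+filter-∁ : ∀ xs → length (filter P? xs) + length (filter (∁? P?) xs) ≡ length xs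
    length-filter+filter-∁ [] = refl
    length-filter+filter-∁ (x ∷ xs) with P? x
    ... | yes _ = cong suc (length-filter+filter-∁ xs)
    ... | no _ = trans (+-suc _ _) (cong suc (length-filter+filter-∁ xs))

∣p∪q∣+∣p∩q∣≡∣p∣+∣q∣ : ∀ {n} (p q : Subset n) → ∣ p ∪ q ∣ + ∣ p ∩ q ∣ ≡ ∣ p ∣ + ∣ q ∣
∣p∪q∣+∣p∩q∣≡∣p∣+∣q∣ [] [] = refl
∣p∪q∣+∣p∩q∣≡∣p∣+∣q∣ (inside ∷ p) (inside ∷ q) =
  cong suc (trans (+-suc _ _) (trans (cong suc (∣p∪q∣+∣p∩q∣≡∣p∣+∣q∣ p q)) (sym (+-suc _ _))))
∣p∪q∣+∣p∩q∣≡∣p∣+∣q∣ (inside ∷ p) (outside ∷ q) = cong suc (∣p∪q∣+∣p∩q∣≡∣p∣+∣q∣ p q)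
∣p∪q∣+∣p∩q∣≡∣p∣+∣q∣ (outside ∷ p) (inside ∷ q) = trans (cong suc (∣p∪q∣+∣p∩q∣≡∣p∣+∣q∣ p q)) (sym (+-suc _ _))
∣p∪q∣+∣p∩q∣≡∣p∣+∣q∣ (outside ∷ p) (outside ∷ q) = ∣p∪q∣+∣p∩q∣≡∣p∣+∣q∣ p q

p⊆q∧∣q∣≤∣p∣⇒p≡q : ∀ {n} {p q : Subset n} → p ⊆ q → ∣ q ∣ ≤ ∣ p ∣ → p ≡ q
p⊆q∧∣q∣≤∣p∣⇒p≡q {p = []} {[]} _ _ = refl
p⊆q∧∣q∣≤∣p∣⇒p≡q {p = inside ∷ p} {inside ∷ q} p⊆q ≤ = cong (inside ∷_) (p⊆q∧∣q∣≤∣p∣⇒p≡q (drop-∷-⊆ p⊆q) (≤-pred ≤))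
p⊆q∧∣q∣≤∣p∣⇒p≡q {p = inside ∷ p} {outside ∷ q} p⊆q _ with p⊆q hereᵥ
... | ()
p⊆q∧∣q∣≤∣p∣⇒p≡q {p = outside ∷ p} {inside ∷ q} p⊆q ≤ =
  ⊥-elim (<⇒≱ (s≤s (p⊆q⇒∣p∣≤∣q∣ (drop-∷-⊆ p⊆q))) ≤)
p⊆q∧∣q∣≤∣p∣⇒p≡q {p = outside ∷ p} {outside ∷ q} p⊆q ≤ = cong (outside ∷_) (p⊆q∧∣q∣≤∣p∣⇒p≡q (drop-∷-⊆ p⊆q) ≤)

∣p∣≤∣p∩q∣⇒p⊆q : ∀ {n} (p q : Subset n) → ∣ p ∣ ≤ ∣ p ∩ q ∣ → p ⊆ q
∣p∣≤∣p∩q∣⇒p⊆q p q ≤ x∈p =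
  p∩q⊆q p q (subst (_ ∈ₛ_) (sym (p⊆q∧∣q∣≤∣p∣⇒p≡q (p∩q⊆p p q) ≤)) x∈p)

module _ {n : ℕ} {p q r : Subset n} where

  ∪-lub : p ⊆ r → q ⊆ r → p ∪ q ⊆ r
  ∪-lub p⊆r q⊆r x∈p∪q with x∈p∪q⁻ p q x∈p∪q
  ... | inj₁ x∈p = p⊆r x∈p
  ... | inj₂ x∈q = q⊆r x∈q

  ∩-glb : r ⊆ p → r ⊆ q → r ⊆ p ∩ q
  ∩-glb r⊆p r⊆q x∈r = x∈p∩q⁺ (r⊆p x∈r , r⊆q x∈r)

p⊈q⇒∣p∩q∣<∣p∣ : ∀ {n} {p q : Subset n} → ¬ p ⊆ q → ∣ p ∩ q ∣ < ∣ p ∣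
p⊈q⇒∣p∩q∣<∣p∣ {p = p} {q} p⊈q = ≰⇒> (λ ∣p∣≤ → p⊈q (∣p∣≤∣p∩q∣⇒p⊆q p q ∣p∣≤))

_≟ₛ_ : ∀ {n} → DecidableEquality (Subset n)
_≟ₛ_ = Vec.≡-dec _≟ᵇ_

module _ {n : ℕ} (p q r : Subset n) where

  [r∩p]∩[r∩q]⊆[p∩q]∩r : (r ∩ p) ∩ (r ∩ q) ⊆ (p ∩ q) ∩ r
  [r∩p]∩[r∩q]⊆[p∩q]∩r x∈ with x∈p∩q⁻ (r ∩ p) (r ∩ q) x∈
  ... | x∈r∩p , x∈r∩q = x∈p∩q⁺ (x∈p∩q⁺ (p∩q⊆q r p x∈r∩p , p∩q⊆q r q x∈r∩q) , p∩q⊆p r p x∈r∩p)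

  [r∩p]∪[r∩q]⊆p∪q : (r ∩ p) ∪ (r ∩ q) ⊆ p ∪ q
  [r∩p]∪[r∩q]⊆p∪q = ∪-lub (λ x∈ → x∈p∪q⁺ (inj₁ (p∩q⊆q r p x∈))) (λ x∈ → x∈p∪q⁺ (inj₂ (p∩q⊆q r q x∈)))

module _ {n k : ℕ} {a b y : Subset n} (a⊆y : a ⊆ y) (b⊆y : b ⊆ y) where

  private
    ∣a∪b∣+∣a∩b∣ : suc ∣ a ∣ ≡ k → suc ∣ b ∣ ≡ k → ∣ a ∪ b ∣ + ∣ a ∩ b ∣ ≡ ∣ a ∣ + ∣ a ∣
    ∣a∪b∣+∣a∩b∣ ∣a∣ ∣b∣ = trans (∣p∪q∣+∣p∩q∣≡∣p∣+∣q∣ a b) (cong (∣ a ∣ +_) (suc-injective (trans ∣b∣ (sym ∣a∣))))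

    ∣a∪b∣≤ : ∣ y ∣ ≡ k → ∣ a ∪ b ∣ ≤ k
    ∣a∪b∣≤ ∣y∣ = ≤-trans (p⊆q⇒∣p∣≤∣q∣ (∪-lub a⊆y b⊆y)) (≤-reflexive ∣y∣)

  facets-∩-large : suc ∣ a ∣ ≡ k → suc ∣ b ∣ ≡ k → ∣ y ∣ ≡ k → k ≤ 2 + ∣ a ∩ b ∣
  facets-∩-large refl ∣b∣ ∣y∣ = s≤s (+-cancelˡ-≤ (∣ a ∣) (∣ a ∣) (suc ∣ a ∩ b ∣) (begin
    ∣ a ∣ + ∣ a ∣           ≡⟨ ∣a∪b∣+∣a∩b∣ refl ∣b∣ ⟨
    ∣ a ∪ b ∣ + ∣ a ∩ b ∣   ≤⟨ +-monoˡ-≤ (∣ a ∩ b ∣) (∣a∪b∣≤ ∣y∣) ⟩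
    suc ∣ a ∣ + ∣ a ∩ b ∣   ≡⟨ +-suc (∣ a ∣) (∣ a ∩ b ∣) ⟨
    ∣ a ∣ + suc ∣ a ∩ b ∣   ∎))
    where open ≤-Reasoning

  facets-∪-cover : suc ∣ a ∣ ≡ k → suc ∣ b ∣ ≡ k → ∣ y ∣ ≡ k → 2 + ∣ a ∩ b ∣ ≤ k → a ∪ b ≡ y
  facets-∪-cover refl ∣b∣ ∣y∣ (s≤s 1+∣a∩b∣≤∣a∣) = p⊆q∧∣q∣≤∣p∣⇒p≡q (∪-lub a⊆y b⊆y)
    (subst (_≤ ∣ a ∪ b ∣) (sym ∣y∣) (+-cancelʳ-≤ (∣ a ∩ b ∣) (suc ∣ a ∣) (∣ a ∪ b ∣) (begin
      suc ∣ a ∣ + ∣ a ∩ b ∣   ≡⟨ +-suc (∣ a ∣) (∣ a ∩ b ∣) ⟨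
      ∣ a ∣ + suc ∣ a ∩ b ∣   ≤⟨ +-monoʳ-≤ (∣ a ∣) 1+∣a∩b∣≤∣a∣ ⟩
      ∣ a ∣ + ∣ a ∣           ≡⟨ ∣a∪b∣+∣a∩b∣ refl ∣b∣ ⟨
      ∣ a ∪ b ∣ + ∣ a ∩ b ∣   ∎)))
    where open ≤-Reasoning

-- Counting the sets of one size in an interval of the Boolean lattice

Layer : ∀ {n} → Subset n → Subset n → ℕ → Subset n → Set
Layer I U b y = I ⊆ y × y ⊆ U × ∣ y ∣ ≡ ∣ I ∣ + b

module _ {n : ℕ} where

  tailsWith : Side → List (Subset (suc n)) → List (Subset n)
  tailsWith s [] = []
  tailsWith s ((t ∷ y) ∷ ys) with s ≟ᵇ t
  ... | yes _ = y ∷ tailsWith s ys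
  ... | no _ = tailsWith s ys

  All-tailsWith : ∀ {s} {P : Pred (Subset (suc n)) 0ℓ} {ys} → All P ys → All (λ y → P (s ∷ y)) (tailsWith s ys)
  All-tailsWith [] = []
  All-tailsWith {s} {ys = (t ∷ y) ∷ _} (py ∷ pys) with s ≟ᵇ t
  ... | yes refl = py ∷ All-tailsWith pys
  ... | no _ = All-tailsWith pys

  tailsWith-unique : ∀ {s ys} → Unique ys → Unique (tailsWith s ys)
  tailsWith-unique {ys = []} _ = AllPairs.[]
  tailsWith-unique {s} {(t ∷ y) ∷ _} (y∉ AllPairs.∷ u) with s ≟ᵇ t
  ... | yes refl = All.map (λ ≢ ≡ → ≢ (cong (s ∷_) ≡)) (All-tailsWith y∉) AllPairs.∷ tailsWith-unique u
  ... | no _ = tailsWith-unique u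

  length-tailsWith : ∀ ys → length (tailsWith inside ys) + length (tailsWith outside ys) ≡ length ys
  length-tailsWith [] = refl
  length-tailsWith ((inside ∷ _) ∷ ys) = cong suc (length-tailsWith ys)
  length-tailsWith ((outside ∷ _) ∷ ys) = trans (+-suc _ _) (cong suc (length-tailsWith ys))

  tailsWith-empty : ∀ {s} {P : Pred (Subset (suc n)) 0ℓ} ys → All P ys → (∀ {y} → ¬ P (s ∷ y)) →
                    length (tailsWith s ys) ≤ 0
  tailsWith-empty ys pys ¬P = ≤-reflexive (cong length (All-absurd⇒≡[] (All-tailsWith {ys = ys} pys) ¬P))

  length≤-tailsWith : ∀ ys {l m} → length (tailsWith inside ys) ≤ l → length (tailsWith outside ys) ≤ m →
                      length ys ≤ l + m
  length≤-tailsWith ys ≤l ≤m = subst (_≤ _) (length-tailsWith ys) (+-mono-≤ ≤l ≤m)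

  module _ {I U : Subset n} {b : ℕ} {y : Subset n} where

    Layer-∷ : ∀ {s t} → Layer (s ∷ I) (t ∷ U) b (s ∷ y) → Layer I U b y
    Layer-∷ {inside} (I⊆y , y⊆U , ∣y∣) = drop-∷-⊆ I⊆y , drop-∷-⊆ y⊆U , suc-injective ∣y∣
    Layer-∷ {outside} (I⊆y , y⊆U , ∣y∣) = drop-∷-⊆ I⊆y , drop-∷-⊆ y⊆U , ∣y∣

    Layer-∷-inside : Layer (outside ∷ I) (inside ∷ U) (suc b) (inside ∷ y) → Layer I U b y
    Layer-∷-inside (I⊆y , y⊆U , ∣y∣) = drop-∷-⊆ I⊆y , drop-∷-⊆ y⊆U , suc-injective (trans ∣y∣ (+-suc _ _))

  ¬Layer-outside-above-inside : ∀ {I : Subset n} {U b y} → ¬ Layer (inside ∷ I) U b (outside ∷ y)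
  ¬Layer-outside-above-inside (I⊆y , _) with I⊆y hereᵥ
  ... | ()

  ¬Layer-inside-below-outside : ∀ {U : Subset n} {I b y} → ¬ Layer I (outside ∷ U) b (inside ∷ y)
  ¬Layer-inside-below-outside (_ , y⊆U , _) with y⊆U hereᵥ
  ... | ()

  ¬Layer₀-inside-above-outside : ∀ {I : Subset n} {U y} → ¬ Layer (outside ∷ I) U 0 (inside ∷ y)
  ¬Layer₀-inside-above-outside {I} (I⊆y , _ , ∣y∣) =
    <⇒≢ (s≤s (p⊆q⇒∣p∣≤∣q∣ (drop-∷-⊆ I⊆y))) (sym (trans ∣y∣ (+-identityʳ ∣ I ∣)))

count-Layer : ∀ {n} {I U : Subset n} {a b} (ys : List (Subset n)) → I ⊆ U → ∣ U ∣ ≡ ∣ I ∣ + a →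
              Unique ys → All (Layer I U b) ys → length ys ≤ a C b
count-Layer {I = []} {[]} [] _ _ _ _ = z≤n
count-Layer {I = []} {[]} ([] ∷ []) _ refl _ ((_ , _ , refl) ∷ []) = ≤-refl
count-Layer {I = []} {[]} ([] ∷ [] ∷ _) _ _ ((≢ ∷ _) AllPairs.∷ _) _ = ⊥-elim (≢ refl)
count-Layer {I = inside ∷ I} {inside ∷ U} {a} {b} ys I⊆U ∣U∣ u ly =
  subst (length ys ≤_) (+-identityʳ (a C b)) (length≤-tailsWith ys
    (count-Layer (tailsWith inside ys) (drop-∷-⊆ I⊆U) (suc-injective ∣U∣)
                 (tailsWith-unique u) (All.map Layer-∷ (All-tailsWith ly)))
    (tailsWith-empty ys ly ¬Layer-outside-above-inside))
count-Layer {I = outside ∷ I} {outside ∷ U} ys I⊆U ∣U∣ u ly = length≤-tailsWith ys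
  (tailsWith-empty ys ly ¬Layer-inside-below-outside)
  (count-Layer (tailsWith outside ys) (drop-∷-⊆ I⊆U) ∣U∣
               (tailsWith-unique u) (All.map Layer-∷ (All-tailsWith ly)))
count-Layer {I = inside ∷ I} {outside ∷ U} _ I⊆U _ _ _ with I⊆U hereᵥ
... | ()
count-Layer {I = outside ∷ I} {inside ∷ U} {zero} _ I⊆U ∣U∣ _ _ =
  ⊥-elim (<⇒≢ (s≤s (p⊆q⇒∣p∣≤∣q∣ (drop-∷-⊆ I⊆U))) (sym (trans ∣U∣ (+-identityʳ ∣ I ∣))))
count-Layer {I = outside ∷ I} {inside ∷ U} {suc a} {zero} ys I⊆U ∣U∣ u ly = length≤-tailsWith ys
  (tailsWith-empty ys ly ¬Layer₀-inside-above-outside)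
  (count-Layer (tailsWith outside ys) (drop-∷-⊆ I⊆U) ∣U∣′
               (tailsWith-unique u) (All.map Layer-∷ (All-tailsWith ly)))
  where ∣U∣′ = suc-injective (trans ∣U∣ (+-suc _ _))
count-Layer {I = outside ∷ I} {inside ∷ U} {suc a} {suc b} ys I⊆U ∣U∣ u ly =
  subst (length ys ≤_) (nCk+nC[k+1]≡[n+1]C[k+1] a b) (length≤-tailsWith ys
    (count-Layer (tailsWith inside ys) (drop-∷-⊆ I⊆U) ∣U∣′
                 (tailsWith-unique u) (All.map Layer-∷-inside (All-tailsWith ly)))
    (count-Layer (tailsWith outside ys) (drop-∷-⊆ I⊆U) ∣U∣′
                 (tailsWith-unique u) (All.map Layer-∷ (All-tailsWith ly))))
  where ∣U∣′ = suc-injective (trans ∣U∣ (+-suc _ _))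

∩⊆-of-⊈ : ∀ {n} {I p q : Subset n} → I ⊆ p → I ⊆ q → ∣ p ∣ ≡ ∣ I ∣ + 1 → ¬ p ⊆ q → p ∩ q ⊆ I
∩⊆-of-⊈ {I = I} {p} {q} I⊆p I⊆q ∣p∣ p⊈q x∈p∩q =
  subst (_ ∈ₛ_) (sym (p⊆q∧∣q∣≤∣p∣⇒p≡q (∩-glb I⊆p I⊆q) ∣p∩q∣≤∣I∣)) x∈p∩q
  where
  ∣p∩q∣≤∣I∣ : ∣ p ∩ q ∣ ≤ ∣ I ∣
  ∣p∩q∣≤∣I∣ = ≤-pred (subst (∣ p ∩ q ∣ <_) (trans ∣p∣ (+-comm ∣ I ∣ 1)) (p⊈q⇒∣p∩q∣<∣p∣ p⊈q))

covers-∩⊆ : ∀ {n} {I U U' p q : Subset n} → Layer I U 1 p → Layer I U' 1 q → p ≢ q → p ∩ q ⊆ I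
covers-∩⊆ (I⊆p , _ , ∣p∣) (I⊆q , _ , ∣q∣) p≢q =
  ∩⊆-of-⊈ I⊆p I⊆q ∣p∣ λ p⊆q → p≢q (p⊆q∧∣q∣≤∣p∣⇒p≡q p⊆q (≤-reflexive (trans ∣q∣ (sym ∣p∣))))

Layer₁-at-most-two : ∀ {n} {I U p q r : Subset n} → I ⊆ U → ∣ U ∣ ≡ ∣ I ∣ + 2 →
                     Layer I U 1 p → Layer I U 1 q → Layer I U 1 r → p ≢ q → p ≢ r → q ≢ r → ⊥
Layer₁-at-most-two I⊆U ∣U∣ lp lq lr p≢q p≢r q≢r = 1+n≰n (count-Layer (_ ∷ _ ∷ _ ∷ []) I⊆U ∣U∣
  ((p≢q ∷ p≢r ∷ []) AllPairs.∷ (q≢r ∷ []) AllPairs.∷ [] AllPairs.∷ AllPairs.[]) (lp ∷ lq ∷ lr ∷ []))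

C-pos : ∀ {n k} → k ≤ n → 0 < n C k
C-pos {k = zero} _ = s≤s z≤n
C-pos {suc n} {suc k} (s≤s k≤n) =
  subst (0 <_) (nCk+nC[k+1]≡[n+1]C[k+1] n k) (≤-trans (C-pos k≤n) (m≤m+n _ _))

n≤nCk : ∀ {n k} → 0 < k → k < n → n ≤ n C k
n≤nCk {suc n} {suc zero} _ _ = ≤-reflexive (sym (nC1≡n (suc n)))
n≤nCk {suc n} {suc (suc k)} _ (s≤s k<n) = subst (suc n ≤_) (nCk+nC[k+1]≡[n+1]C[k+1] n (suc k))
  (subst (_≤ n C suc k + n C suc (suc k)) (+-comm n 1) (+-mono-≤ (n≤nCk (s≤s z≤n) k<n) (C-pos k<n)))

SubsetOfSize : ℕ → ℕ → Set
SubsetOfSize n k = Σ (Subset n) λ A → ∣ A ∣ ≡ k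

module _ {n k : ℕ} where

  ⌊_⌋ : SubsetOfSize n k → Subset n
  ⌊_⌋ = proj₁

  size : (A : SubsetOfSize n k) → ∣ ⌊ A ⌋ ∣ ≡ k
  size = proj₂

  ⌊⌋-injective : ∀ {A B : SubsetOfSize n k} → ⌊ A ⌋ ≡ ⌊ B ⌋ → A ≡ B
  ⌊⌋-injective {_ , ∣A∣} {_ , ∣B∣} refl = cong (_ ,_) (≡-irrelevant ∣A∣ ∣B∣)

inside∷ : ∀ {n k} → SubsetOfSize n k → SubsetOfSize (suc n) (suc k)
inside∷ (A , ∣A∣) = inside ∷ A , cong suc ∣A∣

outside∷ : ∀ {n k} → SubsetOfSize n k → SubsetOfSize (suc n) k
outside∷ (A , ∣A∣) = outside ∷ A , ∣A∣

inside∷-injective : ∀ {n k} {A B : SubsetOfSize n k} → inside∷ A ≡ inside∷ B → A ≡ B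
inside∷-injective ≡ = ⌊⌋-injective (cong (Vec.tail ∘ ⌊_⌋) ≡)

outside∷-injective : ∀ {n k} {A B : SubsetOfSize n k} → outside∷ A ≡ outside∷ B → A ≡ B
outside∷-injective ≡ = ⌊⌋-injective (cong (Vec.tail ∘ ⌊_⌋) ≡)

subsetsOfSize : ∀ n k → List (SubsetOfSize n k)
subsetsOfSize zero zero = ([] , refl) ∷ []
subsetsOfSize zero (suc k) = []
subsetsOfSize (suc n) zero = map outside∷ (subsetsOfSize n zero)
subsetsOfSize (suc n) (suc k) = map inside∷ (subsetsOfSize n k) ++ map outside∷ (subsetsOfSize n (suc k))

length-subsetsOfSize : ∀ n k → length (subsetsOfSize n k) ≡ n C k
length-subsetsOfSize zero zero = refl
length-subsetsOfSize zero (suc k) = refl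
length-subsetsOfSize (suc n) zero =
  trans (length-map outside∷ (subsetsOfSize n zero)) (length-subsetsOfSize n zero)
length-subsetsOfSize (suc n) (suc k) = begin
  length (map inside∷ (subsetsOfSize n k) ++ map outside∷ (subsetsOfSize n (suc k)))
    ≡⟨ length-++ (map inside∷ (subsetsOfSize n k)) ⟩
  length (map inside∷ (subsetsOfSize n k)) + length (map outside∷ (subsetsOfSize n (suc k)))
    ≡⟨ cong₂ _+_ (trans (length-map inside∷ (subsetsOfSize n k)) (length-subsetsOfSize n k))
                 (trans (length-map outside∷ (subsetsOfSize n (suc k))) (length-subsetsOfSize n (suc k))) ⟩
  n C k + n C suc k
    ≡⟨ nCk+nC[k+1]≡[n+1]C[k+1] n k ⟩
  suc n C suc k ∎
  where open ≡-Reasoning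

subsetsOfSize-unique : ∀ n k → Unique (subsetsOfSize n k)
subsetsOfSize-unique zero zero = [] AllPairs.∷ AllPairs.[]
subsetsOfSize-unique zero (suc k) = AllPairs.[]
subsetsOfSize-unique (suc n) zero = Unique.map⁺ outside∷-injective (subsetsOfSize-unique n zero)
subsetsOfSize-unique (suc n) (suc k) = Unique.++⁺
  (Unique.map⁺ inside∷-injective (subsetsOfSize-unique n k))
  (Unique.map⁺ outside∷-injective (subsetsOfSize-unique n (suc k)))
  λ (A∈ , A∈′) → inside≢outside (∈-map⁻ inside∷ A∈) (∈-map⁻ outside∷ A∈′)
  where
  inside≢outside : ∀ {A} → ∃ (λ B → B ∈ subsetsOfSize n k × A ≡ inside∷ B) →
                   ∃ (λ B → B ∈ subsetsOfSize n (suc k) × A ≡ outside∷ B) → ⊥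
  inside≢outside (_ , _ , refl) (_ , _ , ())

AtMostTwoValues : {Y S : Set} → (Y → S) → Set
AtMostTwoValues f = ∀ a b c → f a ≢ f b → f a ≢ f c → f b ≢ f c → ⊥

module _ {Y S T : Set} (f : Y → S) (g : Y → T) where

  Apart : Y → Y → Set
  Apart y y' = f y ≢ f y' × g y ≢ g y'

  module _ (_≟ₛ_ : DecidableEquality S) (f-two : AtMostTwoValues f)
           (injective : ∀ {y y'} → f y ≡ f y' → g y ≡ g y' → y ≡ y') where

    apart-of-third : ∀ {y₁ y₂ y₃} → f y₁ ≢ f y₂ → g y₁ ≡ g y₂ → y₁ ≢ y₃ → y₂ ≢ y₃ →
                     Apart y₁ y₃ ⊎ Apart y₂ y₃
    apart-of-third {y₁} {y₂} {y₃} f₁≢f₂ g₁≡g₂ y₁≢y₃ y₂≢y₃ with f y₁ ≟ₛ f y₃ | f y₂ ≟ₛ f y₃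
    ... | no f₁≢f₃ | no f₂≢f₃ = ⊥-elim (f-two y₁ y₂ y₃ f₁≢f₂ f₁≢f₃ f₂≢f₃)
    ... | yes f₁≡f₃ | _ = inj₂ ( (λ f₂≡f₃ → f₁≢f₂ (trans f₁≡f₃ (sym f₂≡f₃)))
                               , (λ g₂≡g₃ → y₁≢y₃ (injective f₁≡f₃ (trans g₁≡g₂ g₂≡g₃))))
    ... | no f₁≢f₃ | yes f₂≡f₃ = inj₁ (f₁≢f₃ , λ g₁≡g₃ → y₂≢y₃ (injective f₂≡f₃ (trans (sym g₁≡g₂) g₁≡g₃)))

two-by-two : ∀ {Y S T : Set} (f : Y → S) (g : Y → T) → DecidableEquality S → DecidableEquality T →
             AtMostTwoValues f → AtMostTwoValues g → (∀ {y y'} → f y ≡ f y' → g y ≡ g y' → y ≡ y') →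
             ∀ {y₁ y₂ y₃} → y₁ ≢ y₂ → y₁ ≢ y₃ → y₂ ≢ y₃ →
             Apart f g y₁ y₂ ⊎ Apart f g y₁ y₃ ⊎ Apart f g y₂ y₃
two-by-two f g _≟ₛ_ _≟ₜ_ f-two g-two injective {y₁} {y₂} y₁≢y₂ y₁≢y₃ y₂≢y₃ with f y₁ ≟ₛ f y₂ | g y₁ ≟ₜ g y₂
... | yes f≡ | yes g≡ = ⊥-elim (y₁≢y₂ (injective f≡ g≡))
... | no f≢ | no g≢ = inj₁ (f≢ , g≢)
... | no f≢ | yes g≡ = inj₂ (apart-of-third f g _≟ₛ_ f-two injective f≢ g≡ y₁≢y₃ y₂≢y₃)
... | yes f≡ | no g≢ = inj₂ (Sum.map swap swap
  (apart-of-third g f _≟ₜ_ g-two (λ g≡ f≡ → injective f≡ g≡) g≢ f≡ y₁≢y₃ y₂≢y₃))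

module JohnsonComplement (n k : ℕ) where

  open Graph (JohnsonBar n k) public

  private
    6+k≤n+2 : k + 4 ≤ n → 6 + k ≤ n + 2
    6+k≤n+2 k+4≤n = subst (_≤ n + 2) (k+4+2≡6+k k) (+-monoˡ-≤ 2 k+4≤n)
      where
      k+4+2≡6+k : ∀ k → k + 4 + 2 ≡ 6 + k
      k+4+2≡6+k = solve-∀

  -- adjacency in the Johnson graph J(n,k) itself
  _∼_ : V → V → Set
  A ∼ B = suc ∣ ⌊ A ⌋ ∩ ⌊ B ⌋ ∣ ≡ k

  _≟ᵥ_ : DecidableEquality V
  A ≟ᵥ B = map′ ⌊⌋-injective (cong ⌊_⌋) (⌊ A ⌋ ≟ₛ ⌊ B ⌋)

  Adj? : ∀ A B → Dec (Adj A B)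
  Adj? A B = ¬? (⌊ A ⌋ ≟ₛ ⌊ B ⌋) ×-dec (suc ∣ ⌊ A ⌋ ∩ ⌊ B ⌋ ∣ <? k)

  ∼-sym : ∀ {A B : V} → A ∼ B → B ∼ A
  ∼-sym {A} {B} A∼B = trans (cong (λ p → suc ∣ p ∣) (∩-comm ⌊ B ⌋ ⌊ A ⌋)) A∼B

  Adj-sym : ∀ {A B : V} → Adj A B → Adj B A
  Adj-sym {A} {B} (A≢B , A∩B<k) = ≢-sym A≢B , subst (λ p → suc ∣ p ∣ < k) (∩-comm ⌊ A ⌋ ⌊ B ⌋) A∩B<k

  ∼-irrefl : ∀ {A B : V} → A ∼ B → A ≢ B
  ∼-irrefl {A} A∼A refl = 1+n≢n (trans (cong (λ p → suc ∣ p ∣) (sym (∩-idem ⌊ A ⌋))) (trans A∼A (sym (size A))))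

  Adj-irrefl : ∀ {A B : V} → Adj A B → A ≢ B
  Adj-irrefl (⌊A⌋≢⌊B⌋ , _) refl = ⌊A⌋≢⌊B⌋ refl

  ∣∩∣<k : ∀ {A B : V} → A ≢ B → ∣ ⌊ A ⌋ ∩ ⌊ B ⌋ ∣ < k
  ∣∩∣<k {A} {B} A≢B = subst (∣ ⌊ A ⌋ ∩ ⌊ B ⌋ ∣ <_) (size A) (p⊈q⇒∣p∩q∣<∣p∣ λ A⊆B →
    A≢B (⌊⌋-injective (p⊆q∧∣q∣≤∣p∣⇒p≡q A⊆B (≤-reflexive (trans (size B) (sym (size A)))))))

  ¬Adj⇒∼ : ∀ {A B : V} → A ≢ B → ¬ Adj A B → A ∼ B
  ¬Adj⇒∼ A≢B ¬A~B = ≤-antisym (∣∩∣<k A≢B) (≮⇒≥ λ < → ¬A~B ((λ ≡ → A≢B (⌊⌋-injective ≡)) , <))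

  ∼-common-neighbour-Layer : ∀ {u u' y : V} → Adj u u' → y ∼ u → y ∼ u' →
                             Layer (⌊ u ⌋ ∩ ⌊ u' ⌋) (⌊ u ⌋ ∪ ⌊ u' ⌋) 2 ⌊ y ⌋
  ∼-common-neighbour-Layer {u} {u'} {y} (_ , 2+∣I∣≤k) y∼u y∼u' = I⊆y , y⊆U , ∣y∣
    where
    I = ⌊ u ⌋ ∩ ⌊ u' ⌋
    a = ⌊ y ⌋ ∩ ⌊ u ⌋
    b = ⌊ y ⌋ ∩ ⌊ u' ⌋
    a⊆y = p∩q⊆p ⌊ y ⌋ ⌊ u ⌋
    b⊆y = p∩q⊆p ⌊ y ⌋ ⌊ u' ⌋
    a∩b⊆I∩y : a ∩ b ⊆ I ∩ ⌊ y ⌋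
    a∩b⊆I∩y = [r∩p]∩[r∩q]⊆[p∩q]∩r ⌊ u ⌋ ⌊ u' ⌋ ⌊ y ⌋
    k≤2+∣I∩y∣ : k ≤ 2 + ∣ I ∩ ⌊ y ⌋ ∣
    k≤2+∣I∩y∣ = ≤-trans (facets-∩-large a⊆y b⊆y y∼u y∼u' (size y)) (s≤s (s≤s (p⊆q⇒∣p∣≤∣q∣ a∩b⊆I∩y)))
    I⊆y : I ⊆ ⌊ y ⌋
    I⊆y = ∣p∣≤∣p∩q∣⇒p⊆q I ⌊ y ⌋ (≤-pred (≤-pred (≤-trans 2+∣I∣≤k k≤2+∣I∩y∣)))
    ∣a∩b∣≤∣I∣ : ∣ a ∩ b ∣ ≤ ∣ I ∣
    ∣a∩b∣≤∣I∣ = ≤-trans (p⊆q⇒∣p∣≤∣q∣ a∩b⊆I∩y) (∣p∩q∣≤∣p∣ I ⌊ y ⌋)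
    y⊆U : ⌊ y ⌋ ⊆ ⌊ u ⌋ ∪ ⌊ u' ⌋
    y⊆U = subst (_⊆ _) (facets-∪-cover a⊆y b⊆y y∼u y∼u' (size y) (≤-trans (s≤s (s≤s ∣a∩b∣≤∣I∣)) 2+∣I∣≤k))
            ([r∩p]∪[r∩q]⊆p∪q ⌊ u ⌋ ⌊ u' ⌋ ⌊ y ⌋)
    ∣y∣ : ∣ ⌊ y ⌋ ∣ ≡ ∣ I ∣ + 2
    ∣y∣ = trans (size y) (trans (≤-antisym (≤-trans k≤2+∣I∩y∣ (s≤s (s≤s (∣p∩q∣≤∣p∣ I ⌊ y ⌋)))) 2+∣I∣≤k)
                                (+-comm 2 ∣ I ∣))

  -- A common J-neighbour y of the complement-edge u u' is determined by σ y = y ∩ u and τ y = y ∩ u',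
  -- each one of only two sets between u ∩ u' and u (resp. u'); and two such y differing in both are adjacent.
  module CommonNeighbours {u u' : V} (uu' : Adj u u') where

    I : Subset n
    I = ⌊ u ⌋ ∩ ⌊ u' ⌋

    N : Set
    N = Σ V λ y → y ∼ u × y ∼ u'

    σ τ : N → Subset n
    σ (y , _) = ⌊ y ⌋ ∩ ⌊ u ⌋
    τ (y , _) = ⌊ y ⌋ ∩ ⌊ u' ⌋

    layer : (y : N) → Layer I (⌊ u ⌋ ∪ ⌊ u' ⌋) 2 ⌊ proj₁ y ⌋
    layer (y , y∼u , y∼u') = ∼-common-neighbour-Layer {u} {u'} {y} uu' y∼u y∼u'

    k≡∣I∣+2 : N → k ≡ ∣ I ∣ + 2
    k≡∣I∣+2 (y , y∼) = trans (sym (size y)) (proj₂ (proj₂ (layer (y , y∼))))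

    σ-Layer : (y : N) → Layer I ⌊ u ⌋ 1 (σ y)
    σ-Layer y@(_ , y∼u , _) = ∩-glb (proj₁ (layer y)) (p∩q⊆p ⌊ u ⌋ ⌊ u' ⌋) , p∩q⊆q _ _ ,
                              suc-injective (trans y∼u (trans (k≡∣I∣+2 y) (+-suc ∣ I ∣ 1)))

    τ-Layer : (y : N) → Layer I ⌊ u' ⌋ 1 (τ y)
    τ-Layer y@(_ , _ , y∼u') = ∩-glb (proj₁ (layer y)) (p∩q⊆q ⌊ u ⌋ ⌊ u' ⌋) , p∩q⊆q _ _ ,
                               suc-injective (trans y∼u' (trans (k≡∣I∣+2 y) (+-suc ∣ I ∣ 1)))

    σ-two : AtMostTwoValues σ
    σ-two a b c = Layer₁-at-most-two (p∩q⊆p ⌊ u ⌋ ⌊ u' ⌋) (trans (size u) (k≡∣I∣+2 a))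
                          (σ-Layer a) (σ-Layer b) (σ-Layer c)

    τ-two : AtMostTwoValues τ
    τ-two a b c = Layer₁-at-most-two (p∩q⊆q ⌊ u ⌋ ⌊ u' ⌋) (trans (size u') (k≡∣I∣+2 a))
                          (τ-Layer a) (τ-Layer b) (τ-Layer c)

    ⌊⌋≡σ∪τ : (y : N) → ⌊ proj₁ y ⌋ ≡ σ y ∪ τ y
    ⌊⌋≡σ∪τ y = ⊆-antisym y⊆σ∪τ (∪-lub (p∩q⊆p _ _) (p∩q⊆p _ _))
      where
      y⊆σ∪τ : ⌊ proj₁ y ⌋ ⊆ σ y ∪ τ y
      y⊆σ∪τ x∈y with x∈p∪q⁻ ⌊ u ⌋ ⌊ u' ⌋ (proj₁ (proj₂ (layer y)) x∈y)
      ... | inj₁ x∈u = x∈p∪q⁺ (inj₁ (x∈p∩q⁺ (x∈y , x∈u)))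
      ... | inj₂ x∈u' = x∈p∪q⁺ (inj₂ (x∈p∩q⁺ (x∈y , x∈u')))

    σ,τ-injective : ∀ {y y'} → σ y ≡ σ y' → τ y ≡ τ y' → y ≡ y'
    σ,τ-injective {y , y∼} {y' , y'∼} σ≡ τ≡
      with ⌊⌋-injective {A = y} {y'} (trans (⌊⌋≡σ∪τ (y , y∼)) (trans (cong₂ _∪_ σ≡ τ≡) (sym (⌊⌋≡σ∪τ (y' , y'∼)))))
    ... | refl = cong (y ,_) (cong₂ _,_ (≡-irrelevant _ _) (≡-irrelevant _ _))

    Apart⇒Adj : ∀ {y y'} → Apart σ τ y y' → Adj (proj₁ y) (proj₁ y')
    Apart⇒Adj {y} {y'} (σ≢ , τ≢) = (λ ⌊⌋≡ → σ≢ (cong (_∩ ⌊ u ⌋) ⌊⌋≡)) ,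
      ≤-trans (s≤s (s≤s (p⊆q⇒∣p∣≤∣q∣ y∩y'⊆I))) (≤-reflexive (trans (+-comm 2 ∣ I ∣) (sym (k≡∣I∣+2 y))))
      where
      y∩y'⊆I : ⌊ proj₁ y ⌋ ∩ ⌊ proj₁ y' ⌋ ⊆ I
      y∩y'⊆I x∈ with x∈p∩q⁻ _ _ x∈
      ... | x∈y , x∈y' with x∈p∪q⁻ ⌊ u ⌋ ⌊ u' ⌋ (proj₁ (proj₂ (layer y)) x∈y)
      ... | inj₁ x∈u =
        covers-∩⊆ (σ-Layer y) (σ-Layer y') σ≢ (x∈p∩q⁺ (x∈p∩q⁺ (x∈y , x∈u) , x∈p∩q⁺ (x∈y' , x∈u)))
      ... | inj₂ x∈u' =
        covers-∩⊆ (τ-Layer y) (τ-Layer y') τ≢ (x∈p∩q⁺ (x∈p∩q⁺ (x∈y , x∈u') , x∈p∩q⁺ (x∈y' , x∈u')))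

  ∼-common-neighbours-adjacent : ∀ {u u' y₁ y₂ y₃ : V} → Adj u u' →
                                 y₁ ∼ u × y₁ ∼ u' → y₂ ∼ u × y₂ ∼ u' → y₃ ∼ u × y₃ ∼ u' →
                                 y₁ ≢ y₂ → y₁ ≢ y₃ → y₂ ≢ y₃ → Adj y₁ y₂ ⊎ Adj y₁ y₃ ⊎ Adj y₂ y₃
  ∼-common-neighbours-adjacent {u} {u'} {y₁} {y₂} {y₃} uu' c₁ c₂ c₃ y₁≢y₂ y₁≢y₃ y₂≢y₃ =
    Sum.map (Apart⇒Adj {y₁ , c₁} {y₂ , c₂})
            (Sum.map (Apart⇒Adj {y₁ , c₁} {y₃ , c₃}) (Apart⇒Adj {y₂ , c₂} {y₃ , c₃}))
      (two-by-two σ τ _≟ₛ_ _≟ₛ_ σ-two τ-two σ,τ-injective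
        {y₁ , c₁} {y₂ , c₂} {y₃ , c₃} (≢-on-N y₁≢y₂) (≢-on-N y₁≢y₃) (≢-on-N y₂≢y₃))
    where
    open CommonNeighbours {u} {u'} uu'
    ≢-on-N : ∀ {y y' c c'} → y ≢ y' → (y , c) ≢ (y' , c')
    ≢-on-N y≢y' ≡ = y≢y' (cong proj₁ ≡)

  ∣∪∣≡∣∩∣+4 : ∀ {u u' : V} → ∣ ⌊ u ⌋ ∩ ⌊ u' ⌋ ∣ + 2 ≡ k → ∣ ⌊ u ⌋ ∪ ⌊ u' ⌋ ∣ ≡ ∣ ⌊ u ⌋ ∩ ⌊ u' ⌋ ∣ + 4
  ∣∪∣≡∣∩∣+4 {u} {u'} ∣I∣+2≡k = +-cancelʳ-≡ ∣ I ∣ _ _ (begin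
    ∣ ⌊ u ⌋ ∪ ⌊ u' ⌋ ∣ + ∣ I ∣ ≡⟨ ∣p∪q∣+∣p∩q∣≡∣p∣+∣q∣ ⌊ u ⌋ ⌊ u' ⌋ ⟩
    ∣ ⌊ u ⌋ ∣ + ∣ ⌊ u' ⌋ ∣     ≡⟨ cong₂ _+_ (trans (size u) (sym ∣I∣+2≡k)) (trans (size u') (sym ∣I∣+2≡k)) ⟩
    (∣ I ∣ + 2) + (∣ I ∣ + 2)  ≡⟨ i+2+[i+2]≡i+4+i ∣ I ∣ ⟩
    ∣ I ∣ + 4 + ∣ I ∣          ∎)
    where
    I = ⌊ u ⌋ ∩ ⌊ u' ⌋
    open ≡-Reasoning
    i+2+[i+2]≡i+4+i : ∀ i → (i + 2) + (i + 2) ≡ i + 4 + i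
    i+2+[i+2]≡i+4+i = solve-∀

  Layer₂-∼-common-neighbour : ∀ {I U} {a a' x : V} → Adj a a' → x ∼ a → x ∼ a' →
                              Layer I U 2 ⌊ a ⌋ → Layer I U 2 ⌊ a' ⌋ → Layer I U 2 ⌊ x ⌋
  Layer₂-∼-common-neighbour {a = a} {a'} {x} aa' x∼a x∼a' (I⊆a , a⊆U , ∣a∣) (I⊆a' , a'⊆U , _) =
    (λ z∈I → I'⊆x (x∈p∩q⁺ (I⊆a z∈I , I⊆a' z∈I))) , (λ z∈x → ∪-lub a⊆U a'⊆U (x⊆U' z∈x)) ,
    trans (size x) (trans (sym (size a)) ∣a∣)
    where
    I'⊆x = proj₁ (∼-common-neighbour-Layer {a} {a'} {x} aa' x∼a x∼a')
    x⊆U' = proj₁ (proj₂ (∼-common-neighbour-Layer {a} {a'} {x} aa' x∼a x∼a'))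

  ∼-bipartite-bound : ∀ {X Y : List V} → Unique X → Unique Y → (∀ {x y} → x ∈ X → y ∈ Y → x ∼ y) →
                      ∀ {u u' a a' : V} → u ∈ X → u' ∈ X → Adj u u' → a ∈ Y → a' ∈ Y → Adj a a' →
                      length X + length Y ≤ 6
  ∼-bipartite-bound {X} {Y} uX uY X∼Y {u} {u'} {a} {a'} u∈X u'∈X uu' a∈Y a'∈Y aa' =
    subst (_≤ 6) (trans (length-map ⌊_⌋ (X ++ Y)) (length-++ X))
      (count-Layer (map ⌊_⌋ (X ++ Y)) I⊆U (∣∪∣≡∣∩∣+4 {u} {u'} ∣I∣+2≡k)
        (Unique.map⁺ ⌊⌋-injective (Unique.++⁺ uX uY disjoint)) (All.tabulate in-Layer))
    where
    I = ⌊ u ⌋ ∩ ⌊ u' ⌋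
    U = ⌊ u ⌋ ∪ ⌊ u' ⌋
    I⊆U : I ⊆ U
    I⊆U x∈I = x∈p∪q⁺ (inj₁ (p∩q⊆p _ _ x∈I))
    Y-Layer : ∀ {y} → y ∈ Y → Layer I U 2 ⌊ y ⌋
    Y-Layer {y} y∈Y = ∼-common-neighbour-Layer {u} {u'} {y} uu' (∼-sym {u} {y} (X∼Y u∈X y∈Y))
                                                                 (∼-sym {u'} {y} (X∼Y u'∈X y∈Y))
    ∣I∣+2≡k : ∣ I ∣ + 2 ≡ k
    ∣I∣+2≡k = trans (sym (proj₂ (proj₂ (Y-Layer a∈Y)))) (size a)
    in-Layer : ∀ {s} → s ∈ map ⌊_⌋ (X ++ Y) → Layer I U 2 s
    in-Layer s∈ with ∈-map⁻ ⌊_⌋ s∈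
    ... | z , z∈X++Y , refl with ∈-++⁻ X z∈X++Y
    ... | inj₁ z∈X = Layer₂-∼-common-neighbour {a = a} {a'} {z} aa' (X∼Y z∈X a∈Y) (X∼Y z∈X a'∈Y)
                                                (Y-Layer a∈Y) (Y-Layer a'∈Y)
    ... | inj₂ z∈Y = Y-Layer z∈Y
    disjoint : ∀ {z} → z ∈ X × z ∈ Y → ⊥
    disjoint {z} (z∈X , z∈Y) = ∼-irrefl {z} {z} (X∼Y z∈X z∈Y) refl

  ∼-bipartite-bound₃ : ∀ {X Y : List V} → Unique X → Unique Y → (∀ {x y} → x ∈ X → y ∈ Y → x ∼ y) →
                       ∀ {u u' : V} → u ∈ X → u' ∈ X → Adj u u' → 3 ≤ length Y → length X + length Y ≤ 6
  ∼-bipartite-bound₃ {Y = []} _ _ _ _ _ _ ()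
  ∼-bipartite-bound₃ {Y = _ ∷ []} _ _ _ _ _ _ (s≤s ())
  ∼-bipartite-bound₃ {Y = _ ∷ _ ∷ []} _ _ _ _ _ _ (s≤s (s≤s ()))
  ∼-bipartite-bound₃ {X} {Y@(y₁ ∷ y₂ ∷ y₃ ∷ _)}
    uX uY@((y₁≢y₂ ∷ y₁≢y₃ ∷ _) AllPairs.∷ (y₂≢y₃ ∷ _) AllPairs.∷ _) X∼Y {u} {u'} u∈X u'∈X uu' _ =
    Sum.[ bound y₁∈ y₂∈ , Sum.[ bound y₁∈ y₃∈ , bound y₂∈ y₃∈ ]′ ]′
      (∼-common-neighbours-adjacent {u} {u'} {y₁} {y₂} {y₃} uu' (nb y₁∈) (nb y₂∈) (nb y₃∈) y₁≢y₂ y₁≢y₃ y₂≢y₃)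
    where
    y₁∈ : y₁ ∈ Y
    y₁∈ = here refl
    y₂∈ : y₂ ∈ Y
    y₂∈ = there (here refl)
    y₃∈ : y₃ ∈ Y
    y₃∈ = there (there (here refl))
    nb : ∀ {y} → y ∈ Y → y ∼ u × y ∼ u'
    nb {y} y∈Y = ∼-sym {u} {y} (X∼Y u∈X y∈Y) , ∼-sym {u'} {y} (X∼Y u'∈X y∈Y)
    bound : ∀ {a a'} → a ∈ Y → a' ∈ Y → Adj a a' → length X + length Y ≤ 6
    bound = ∼-bipartite-bound uX uY X∼Y u∈X u'∈X uu'

  ∼⇒∣∪∣≡1+k : ∀ {A B : V} → A ∼ B → ∣ ⌊ A ⌋ ∪ ⌊ B ⌋ ∣ ≡ suc k
  ∼⇒∣∪∣≡1+k {A} {B} A∼B = +-cancelʳ-≡ ∣ I ∣ _ _ (begin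
    ∣ ⌊ A ⌋ ∪ ⌊ B ⌋ ∣ + ∣ I ∣ ≡⟨ ∣p∪q∣+∣p∩q∣≡∣p∣+∣q∣ ⌊ A ⌋ ⌊ B ⌋ ⟩
    ∣ ⌊ A ⌋ ∣ + ∣ ⌊ B ⌋ ∣     ≡⟨ cong₂ _+_ (size A) (trans (size B) (sym A∼B)) ⟩
    k + suc ∣ I ∣             ≡⟨ +-suc k ∣ I ∣ ⟩
    suc k + ∣ I ∣             ∎)
    where
    I = ⌊ A ⌋ ∩ ⌊ B ⌋
    open ≡-Reasoning

  ∼-Clique : List V → Set
  ∼-Clique W = ∀ {A B} → A ∈ W → B ∈ W → A ≢ B → A ∼ B

  -- The two kinds of cliques of J(n,k): k-sets through a common (k-1)-set, and k-sets inside a common (k+1)-set.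
  star-bound : ∀ {I : Subset n} {W : List V} → suc ∣ I ∣ ≡ k → Unique W → All (λ D → I ⊆ ⌊ D ⌋) W →
               length W + k ≤ n + 1
  star-bound {I} {W} ∣I∣ uW I⊆W = begin
    length W + k            ≡⟨ cong (length W +_) ∣I∣ ⟨
    length W + suc ∣ I ∣    ≤⟨ +-monoˡ-≤ (suc ∣ I ∣) length≤ ⟩
    n ∸ ∣ I ∣ + suc ∣ I ∣   ≡⟨ +-suc (n ∸ ∣ I ∣) ∣ I ∣ ⟩
    suc (n ∸ ∣ I ∣ + ∣ I ∣) ≡⟨ cong suc (m∸n+n≡m (∣p∣≤n I)) ⟩
    suc n                   ≡⟨ +-comm 1 n ⟩
    n + 1                   ∎
    where
    open ≤-Reasoning
    I⊆⇒Layer : ∀ {D : V} → I ⊆ ⌊ D ⌋ → Layer I full 1 ⌊ D ⌋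
    I⊆⇒Layer {D} I⊆D = I⊆D , ⊆⊤ , trans (size D) (trans (sym ∣I∣) (+-comm 1 ∣ I ∣))
    length≤ : length W ≤ n ∸ ∣ I ∣
    length≤ = subst₂ _≤_ (length-map ⌊_⌋ W) (nC1≡n (n ∸ ∣ I ∣))
      (count-Layer (map ⌊_⌋ W) ⊆⊤ (trans (∣⊤∣≡n n) (sym (m+[n∸m]≡n (∣p∣≤n I))))
        (Unique.map⁺ ⌊⌋-injective uW)
        (All.map⁺ (All.map (λ {D} → I⊆⇒Layer {D}) I⊆W)))

  top-bound : ∀ {U : Subset n} {W : List V} → ∣ U ∣ ≡ suc k → Unique W → All (λ D → ⌊ D ⌋ ⊆ U) W →
              length W ≤ k + 1
  top-bound {U} {W} ∣U∣ uW W⊆U = subst₂ _≤_ (length-map ⌊_⌋ W) 1+kCk≡k+1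
    (count-Layer (map ⌊_⌋ W) ⊥⊆ (trans ∣U∣ (cong (_+ suc k) (sym (∣⊥∣≡0 n))))
      (Unique.map⁺ ⌊⌋-injective uW)
      (All.map⁺ (All.map (λ {D} → ⊆U⇒Layer {D}) W⊆U)))
    where
    ⊆U⇒Layer : ∀ {D : V} → ⌊ D ⌋ ⊆ U → Layer ∅ U k ⌊ D ⌋
    ⊆U⇒Layer {D} D⊆U = ⊥⊆ , D⊆U , trans (size D) (cong (_+ k) (sym (∣⊥∣≡0 n)))
    1+kCk≡k+1 : suc k C k ≡ k + 1
    1+kCk≡k+1 = trans (nCk≡nC[n∸k] (n≤1+n k))
                  (trans (cong (suc k C_) (m+n∸n≡m 1 k)) (trans (nC1≡n (suc k)) (+-comm 1 k)))

  ∼-common-neighbour-⊆∪ : ∀ {A B D : V} → A ∼ B → D ∼ A → D ∼ B → ¬ ⌊ A ⌋ ∩ ⌊ B ⌋ ⊆ ⌊ D ⌋ →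
                          ⌊ D ⌋ ⊆ ⌊ A ⌋ ∪ ⌊ B ⌋
  ∼-common-neighbour-⊆∪ {A} {B} {D} A∼B D∼A D∼B I⊈D =
    subst (_⊆ _) (facets-∪-cover (p∩q⊆p ⌊ D ⌋ ⌊ A ⌋) (p∩q⊆p ⌊ D ⌋ ⌊ B ⌋) D∼A D∼B (size D) 2+∣a∩b∣≤k)
      ([r∩p]∪[r∩q]⊆p∪q ⌊ A ⌋ ⌊ B ⌋ ⌊ D ⌋)
    where
    2+∣a∩b∣≤k : 2 + ∣ (⌊ D ⌋ ∩ ⌊ A ⌋) ∩ (⌊ D ⌋ ∩ ⌊ B ⌋) ∣ ≤ k
    2+∣a∩b∣≤k = ≤-trans (s≤s (s≤s (p⊆q⇒∣p∣≤∣q∣ ([r∩p]∩[r∩q]⊆[p∩q]∩r ⌊ A ⌋ ⌊ B ⌋ ⌊ D ⌋))))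
                        (≤-trans (s≤s (p⊈q⇒∣p∩q∣<∣p∣ I⊈D)) (≤-reflexive A∼B))

  ∼-clique-⊆∪ : ∀ {W : List V} → ∼-Clique W →
                ∀ {A B D₂ : V} → A ∈ W → B ∈ W → A ≢ B → D₂ ∈ W → ¬ ⌊ A ⌋ ∩ ⌊ B ⌋ ⊆ ⌊ D₂ ⌋ →
                ∀ {D : V} → D ∈ W → ⌊ D ⌋ ⊆ ⌊ A ⌋ ∪ ⌊ B ⌋
  ∼-clique-⊆∪ {W} clique {A} {B} {D₂} A∈W B∈W A≢B D₂∈W I⊈D₂ {D} D∈W =
    decidable-stable (⌊ D ⌋ ⊆? U) λ D⊈U →
      I⊆D⇒¬¬D⊆U (decidable-stable (I ⊆? ⌊ D ⌋) (λ I⊈D → D⊈U (⊆U-unless-I⊆ D∈W I⊈D))) D⊈U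
    where
    I = ⌊ A ⌋ ∩ ⌊ B ⌋
    U = ⌊ A ⌋ ∪ ⌊ B ⌋
    A∼B = clique A∈W B∈W A≢B
    ⊆U-unless-I⊆ : ∀ {E : V} → E ∈ W → ¬ I ⊆ ⌊ E ⌋ → ⌊ E ⌋ ⊆ U
    ⊆U-unless-I⊆ {E} E∈W I⊈E = decidable-stable (⌊ E ⌋ ⊆? U) λ E⊈U →
      E⊈U (∼-common-neighbour-⊆∪ {A} {B} {E} A∼B (clique E∈W A∈W λ { refl → E⊈U (λ x∈ → x∈p∪q⁺ (inj₁ x∈)) })
                                                 (clique E∈W B∈W λ { refl → E⊈U (λ x∈ → x∈p∪q⁺ (inj₂ x∈)) }) I⊈E)
    -- D would meet D₂ only inside I ∩ D₂, which is too small for D ∼ D₂.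
    I⊆D⇒¬¬D⊆U : I ⊆ ⌊ D ⌋ → ¬ ¬ ⌊ D ⌋ ⊆ U
    I⊆D⇒¬¬D⊆U I⊆D D⊈U = <⇒≢ (≤-trans (s≤s (s≤s (p⊆q⇒∣p∣≤∣q∣ D∩D₂⊆I∩D₂)))
                                   (≤-trans (s≤s (p⊈q⇒∣p∩q∣<∣p∣ I⊈D₂)) (≤-reflexive A∼B)))
                          (clique D∈W D₂∈W λ { refl → I⊈D₂ I⊆D })
      where
      D∩U⊆I : ⌊ D ⌋ ∩ U ⊆ I
      D∩U⊆I = ∩⊆-of-⊈ I⊆D (λ x∈I → x∈p∪q⁺ (inj₁ (p∩q⊆p _ _ x∈I)))
                         (trans (size D) (trans (sym A∼B) (+-comm 1 ∣ I ∣))) D⊈U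
      D∩D₂⊆I∩D₂ : ⌊ D ⌋ ∩ ⌊ D₂ ⌋ ⊆ I ∩ ⌊ D₂ ⌋
      D∩D₂⊆I∩D₂ x∈ with x∈p∩q⁻ ⌊ D ⌋ ⌊ D₂ ⌋ x∈
      ... | x∈D , x∈D₂ = x∈p∩q⁺ (D∩U⊆I (x∈p∩q⁺ (x∈D , ⊆U-unless-I⊆ D₂∈W I⊈D₂ x∈D₂)) , x∈D₂)

  ∼-clique-bound : ∀ {W : List V} → Unique W → ∼-Clique W →
                   length W + k ≤ n + 1 ⊎ length W ≤ k + 1
  ∼-clique-bound {[]} _ _ = inj₂ z≤n
  ∼-clique-bound {_ ∷ []} _ _ = inj₂ (m≤n+m 1 k)
  ∼-clique-bound {W@(A ∷ B ∷ _)} uW@((A≢B ∷ _) AllPairs.∷ _) clique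
    with All.all? (λ D → ⌊ A ⌋ ∩ ⌊ B ⌋ ⊆? ⌊ D ⌋) W
  ... | yes I⊆W = inj₁ (star-bound (clique (here refl) (there (here refl)) A≢B) uW I⊆W)
  ... | no I⊈W with find (All.¬All⇒Any¬ (λ D → ⌊ A ⌋ ∩ ⌊ B ⌋ ⊆? ⌊ D ⌋) W I⊈W)
  ... | D₂ , D₂∈W , I⊈D₂ = inj₂ (top-bound (∼⇒∣∪∣≡1+k {A} {B} (clique (here refl) (there (here refl)) A≢B)) uW
          (All.tabulate (∼-clique-⊆∪ clique (here refl) (there (here refl)) A≢B D₂∈W I⊈D₂)))

  open DecMembership _≟ᵥ_ using (_∈?_)

  data Connected : List V → Set where
    single : ∀ v → Connected (v ∷ [])
    extend : ∀ {v w L} → w ∈ L → Adj v w → Connected L → Connected (v ∷ L)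

  HasEdge : List V → Set
  HasEdge L = ∃₂ λ u u' → u ∈ L × u' ∈ L × Adj u u'

  HasEdge⇒2≤length : ∀ {L} → HasEdge L → 2 ≤ length L
  HasEdge⇒2≤length (u , u' , u∈L , u'∈L , uu') = two-members⇒2≤length u∈L u'∈L (Adj-irrefl {u} {u'} uu')

  Connected⇒HasEdge : ∀ {L} → Connected L → 2 ≤ length L → HasEdge L
  Connected⇒HasEdge (single _) (s≤s ())
  Connected⇒HasEdge (extend {v} {w} w∈L vw _) _ = v , w , here refl , there w∈L , vw

  record Piece (W : List V) : Set where
    field
      vertices           : List V
      vertices-unique    : Unique vertices
      vertices-connected : Connected vertices
      vertices⊆W         : ∀ {x} → x ∈ vertices → x ∈ W

  open Piece

  Closed : List V → List V → Set
  Closed W L = ∀ {w} → w ∈ W → w ∉ L → ∀ {y} → y ∈ L → ¬ Adj w y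

  LargePiece : List V → Set
  LargePiece W = Σ (Piece W) λ F → 5 ≤ length (vertices F)

  ClosedPieceAround : List V → List V → Set
  ClosedPieceAround W L = Σ (Piece W) λ X →
    Closed W (vertices X) × length (vertices X) ≤ 4 × (∀ {x} → x ∈ L → x ∈ vertices X)

  grow : ∀ {W} f (P : Piece W) → 5 ≤ f + length (vertices P) → LargePiece W ⊎ ClosedPieceAround W (vertices P)
  grow {W} f P 5≤f+∣P∣ with 5 ≤? length (vertices P) | f
  ... | yes 5≤∣P∣ | _ = inj₁ (P , 5≤∣P∣)
  ... | no ∣P∣≱5 | zero = ⊥-elim (∣P∣≱5 5≤f+∣P∣)
  ... | no ∣P∣≱5 | suc f with any? (λ w → ¬? (w ∈? vertices P) ×-dec any? (Adj? w) (vertices P)) W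
  ... | no none = inj₂ (P , closed , ≤-pred (≰⇒> ∣P∣≱5) , λ x∈P → x∈P)
    where
    closed : Closed W (vertices P)
    closed w∈W w∉P y∈P wy = none (lose w∈W (w∉P , lose y∈P wy))
  ... | yes some with find some
  ... | w , w∈W , w∉P , w~P with find w~P
  ... | y , y∈P , wy = Sum.map₂ forget-w (grow f P+w (subst (5 ≤_) (sym (+-suc f _)) 5≤f+∣P∣))
    where
    P+w : Piece W
    P+w = record { vertices = w ∷ vertices P ; vertices-unique = unique-∷ w∉P (vertices-unique P)
                 ; vertices-connected = extend {w} {y} y∈P wy (vertices-connected P)
                 ; vertices⊆W = λ { (here refl) → w∈W ; (there x∈P) → vertices⊆W P x∈P } }
    forget-w : ClosedPieceAround W (w ∷ vertices P) → ClosedPieceAround W (vertices P)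
    forget-w (X , closed , ∣X∣≤4 , ⊇w∷P) = X , closed , ∣X∣≤4 , λ x∈P → ⊇w∷P (there x∈P)

  edge-or-clique : ∀ W → HasEdge W ⊎ ∼-Clique W
  edge-or-clique W with any? (λ x → any? (Adj? x) W) W
  ... | yes some with find some
  ... | u , u∈W , u~W with find u~W
  ... | u' , u'∈W , uu' = inj₁ (u , u' , u∈W , u'∈W , uu')
  edge-or-clique W | no none = inj₂ λ A∈W B∈W A≢B → ¬Adj⇒∼ A≢B λ AB → none (lose A∈W (lose B∈W AB))

  closed-piece-bound : ∀ {X Z : List V} → Unique X → Unique Z → HasEdge X → length X ≤ 4 →
                       (∀ {x z} → x ∈ X → z ∈ Z → x ≢ z × ¬ Adj x z) → length X + length Z ≤ 6
  closed-piece-bound {X} {Z} uX uZ (u , u' , u∈X , u'∈X , uu') ∣X∣≤4 apart with 3 ≤? length Z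
  ... | yes 3≤∣Z∣ = ∼-bipartite-bound₃ uX uZ X∼Z {u} {u'} u∈X u'∈X uu' 3≤∣Z∣
    where
    X∼Z : ∀ {x z} → x ∈ X → z ∈ Z → x ∼ z
    X∼Z x∈X z∈Z = ¬Adj⇒∼ (proj₁ (apart x∈X z∈Z)) (proj₂ (apart x∈X z∈Z))
  ... | no ∣Z∣≱3 = +-mono-≤ ∣X∣≤4 (≤-pred (≰⇒> ∣Z∣≱3))

  edge-piece : ∀ {W u u'} → u ∈ W → u' ∈ W → Adj u u' → Piece W
  edge-piece {u = u} {u'} u∈W u'∈W uu' = record
    { vertices = u ∷ u' ∷ []
    ; vertices-unique = unique-∷ (λ { (here refl) → Adj-irrefl {u} {u} uu' refl }) (unique-∷ (λ ()) AllPairs.[])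
    ; vertices-connected = extend {u} {u'} (here refl) uu' (single u')
    ; vertices⊆W = λ { (here refl) → u∈W ; (there (here refl)) → u'∈W } }

  clique-small : ∀ {W} → Unique W → ∼-Clique W → k + k ≤ n →
                 length W + k ≤ n + 1
  clique-small {W} uW clique 2k≤n with ∼-clique-bound uW clique
  ... | inj₁ ∣W∣+k≤n+1 = ∣W∣+k≤n+1
  ... | inj₂ ∣W∣≤k+1 = begin
    length W + k ≤⟨ +-monoˡ-≤ k ∣W∣≤k+1 ⟩
    k + 1 + k    ≡⟨ k+1+k≡k+k+1 k ⟩
    k + k + 1    ≤⟨ +-monoˡ-≤ 1 2k≤n ⟩
    n + 1        ∎
    where
    open ≤-Reasoning
    k+1+k≡k+k+1 : ∀ k → k + 1 + k ≡ k + k + 1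
    k+1+k≡k+k+1 = solve-∀

  record DominatingPiece (W : List V) : Set where
    field
      piece     : Piece W
      edge      : HasEdge (vertices piece)
      dominates : ∀ {w} → w ∉ W → ∃ λ p → p ∈ vertices piece × Adj w p
      small     : length W + k ≤ n + 2

  dominating-piece : ∀ {W} → Unique W → k + 4 ≤ n → 6 ≤ length W → (X : Piece W) → Closed W (vertices X) →
                     length (vertices X) ≤ 4 → HasEdge (vertices X) → DominatingPiece W
  dominating-piece {W} uW k+4≤n 6≤∣W∣ X closed ∣X∣≤4 edge =
    record { piece = X ; edge = edge ; dominates = dominates ; small = small }
    where
    Y = filter (∁? (_∈? vertices X)) W
    uY : Unique Y
    uY = Unique.filter⁺ (∁? (_∈? vertices X)) uW
    Y⊆W : ∀ {y} → y ∈ Y → y ∈ W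
    Y⊆W y∈Y = proj₁ (∈-filter⁻ (∁? (_∈? vertices X)) {xs = W} y∈Y)
    Y∩X=∅ : ∀ {y} → y ∈ Y → y ∉ vertices X
    Y∩X=∅ y∈Y = proj₂ (∈-filter⁻ (∁? (_∈? vertices X)) {xs = W} y∈Y)
    ∣W∣≤∣X∣+∣Y∣ : length W ≤ length (vertices X) + length Y
    ∣W∣≤∣X∣+∣Y∣ = subst (_≤ length (vertices X) + length Y) (length-filter+filter-∁ (_∈? vertices X) W)
      (+-monoˡ-≤ (length Y) (unique⊆⇒length≤ (Unique.filter⁺ (_∈? vertices X) uW)
                                            (λ x∈ → proj₂ (∈-filter⁻ (_∈? vertices X) {xs = W} x∈))))
    X-Y-apart : ∀ {x y} → x ∈ vertices X → y ∈ Y → x ≢ y × ¬ Adj x y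
    X-Y-apart {x} {y} x∈X y∈Y = (λ { refl → Y∩X=∅ y∈Y x∈X }) ,
                                λ xy → closed (Y⊆W y∈Y) (Y∩X=∅ y∈Y) x∈X (Adj-sym {x} {y} xy)
    small : length W + k ≤ n + 2
    small = ≤-trans
      (+-monoˡ-≤ k (≤-trans ∣W∣≤∣X∣+∣Y∣ (closed-piece-bound (vertices-unique X) uY edge ∣X∣≤4 X-Y-apart)))
                    (6+k≤n+2 k+4≤n)
    dominates : ∀ {w} → w ∉ W → ∃ λ p → p ∈ vertices X × Adj w p
    dominates {w} w∉W with any? (Adj? w) (vertices X)
    ... | yes some = find some
    ... | no none = ⊥-elim (1+n≰n (begin
      7                                    ≤⟨ s≤s (≤-trans 6≤∣W∣ ∣W∣≤∣X∣+∣Y∣) ⟩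
      suc (length (vertices X) + length Y) ≡⟨ +-suc (length (vertices X)) (length Y) ⟨
      length (vertices X) + length (w ∷ Y) ≤⟨ closed-piece-bound (vertices-unique X) uw∷Y edge ∣X∣≤4 X-w∷Y-apart ⟩
      6                                    ∎))
      where
      open ≤-Reasoning
      X-w∷Y-apart : ∀ {x z} → x ∈ vertices X → z ∈ w ∷ Y → x ≢ z × ¬ Adj x z
      X-w∷Y-apart {x} x∈X (here refl) =
        (λ { refl → w∉W (vertices⊆W X x∈X) }) , λ xw → none (lose x∈X (Adj-sym {x} {w} xw))
      X-w∷Y-apart x∈X (there y∈Y) = X-Y-apart x∈X y∈Y
      uw∷Y : Unique (w ∷ Y)
      uw∷Y = unique-∷ (λ w∈Y → w∉W (Y⊆W w∈Y)) uY

  trichotomy : ∀ {W} → Unique W → k + 4 ≤ n → k + k ≤ n →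
               length W + k ≤ n + 1 ⊎ LargePiece W ⊎ DominatingPiece W
  trichotomy {W} uW k+4≤n 2k≤n with length W + k ≤? n + 1
  ... | yes ∣W∣+k≤n+1 = inj₁ ∣W∣+k≤n+1
  ... | no ∣W∣+k≰n+1 with edge-or-clique W
  ... | inj₂ clique = inj₁ (clique-small uW clique 2k≤n)
  ... | inj₁ (u , u' , u∈W , u'∈W , uu') with grow 3 (edge-piece {W} {u} {u'} u∈W u'∈W uu') ≤-refl
  ... | inj₁ large = inj₂ (inj₁ large)
  ... | inj₂ (X , closed , ∣X∣≤4 , ⊇uu') = inj₂ (inj₂ (dominating-piece uW k+4≤n 6≤∣W∣ X closed ∣X∣≤4
          (u , u' , ⊇uu' (here refl) , ⊇uu' (there (here refl)) , uu')))
    where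
    6≤∣W∣ : 6 ≤ length W
    6≤∣W∣ = +-cancelʳ-≤ k 6 (length W)
      (≤-trans (6+k≤n+2 k+4≤n) (subst (_≤ length W + k) (sym (+-suc n 1)) (≰⇒> ∣W∣+k≰n+1)))

-- Rooted trees

module RootedTree (T : Tree) where

  open Tree T

  -- x ≼ z: z lies in the subtree rooted at x
  data _≼_ (x : Node) : Node → Set where
    ≼-refl  : x ≼ x
    ≼-child : ∀ {i} → x ≼ parent i → x ≼ fsuc i

  ≼⇒≤ : ∀ {x z} → x ≼ z → toℕ x ≤ toℕ z
  ≼⇒≤ ≼-refl = ≤-refl
  ≼⇒≤ (≼-child {i} x≼pi) = m≤n⇒m≤1+n (≤-trans (≼⇒≤ x≼pi) (parent< i))

  private
    ≼?-bounded : ∀ f x z → toℕ z ≤ f → Dec (x ≼ z)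
    ≼?-bounded f x z _ with x Fin.≟ z
    ... | yes refl = yes ≼-refl
    ≼?-bounded f x fzero _ | no x≢z = no λ { ≼-refl → x≢z refl }
    ≼?-bounded (suc f) x (fsuc i) (s≤s i≤f) | no x≢z with ≼?-bounded f x (parent i) (≤-trans (parent< i) i≤f)
    ... | yes x≼pi = yes (≼-child x≼pi)
    ... | no x⋠pi = no λ { ≼-refl → x≢z refl ; (≼-child x≼pi) → x⋠pi x≼pi }

    root≼-bounded : ∀ f z → toℕ z ≤ f → fzero ≼ z
    root≼-bounded f fzero _ = ≼-refl
    root≼-bounded (suc f) (fsuc i) (s≤s i≤f) = ≼-child (root≼-bounded f (parent i) (≤-trans (parent< i) i≤f))

  _≼?_ : ∀ x z → Dec (x ≼ z)
  x ≼? z = ≼?-bounded (toℕ z) x z ≤-refl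

  root≼ : ∀ z → fzero ≼ z
  root≼ z = root≼-bounded (toℕ z) z ≤-refl

  ≼-via-child : ∀ {x z} → x ≼ z → z ≢ x → ∃ λ i → parent i ≡ x × fsuc i ≼ z
  ≼-via-child ≼-refl z≢x = ⊥-elim (z≢x refl)
  ≼-via-child {x} (≼-child {i} x≼pi) _ with parent i Fin.≟ x
  ... | yes pi≡x = i , pi≡x , ≼-refl
  ... | no pi≢x with ≼-via-child x≼pi pi≢x
  ... | j , pj≡x , sj≼pi = j , pj≡x , ≼-child sj≼pi

  child-⋠-parent : ∀ {i x} → parent i ≡ x → ¬ fsuc i ≼ x
  child-⋠-parent {i} refl si≼pi = 1+n≰n (≤-trans (s≤s (parent< i)) (≼⇒≤ si≼pi))

  child-index : ∀ {i x} → parent i ≡ x → suc (toℕ x) ≤ toℕ (fsuc i) × toℕ (fsuc i) ≤ m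
  child-index {i} refl = s≤s (parent< i) , Fin.toℕ<n i

  walk-start : ∀ {S a b} → WalkIn S a b → S a
  walk-start (here s) = s
  walk-start (step s _ _) = s

  walk-enters-through : ∀ {S z a b} → WalkIn S a b → ¬ z ≼ a → z ≼ b → S z
  walk-enters-through (here _) z⋠a z≼b = ⊥-elim (z⋠a z≼b)
  walk-enters-through {z = z} (step {y = a'} _ aa' walk) z⋠a z≼b with z ≼? a'
  ... | no z⋠a' = walk-enters-through walk z⋠a' z≼b
  ... | yes z≼a' with aa'
  ...   | j , inj₁ (refl , refl) = ⊥-elim (z⋠a (≼-child z≼a'))
  ...   | j , inj₂ (refl , refl) with z≼a'
  ...     | ≼-refl = walk-start walk
  ...     | ≼-child z≼a = ⊥-elim (z⋠a z≼a)

  walk-stays-outside : ∀ {S x a b} → ¬ S x → WalkIn S a b → ¬ x ≼ a → ¬ x ≼ b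
  walk-stays-outside ¬Sx walk x⋠a x≼b = ¬Sx (walk-enters-through walk x⋠a x≼b)

  walk-stays-below : ∀ {S i x a b} → parent i ≡ x → ¬ S x → WalkIn S a b → fsuc i ≼ a → fsuc i ≼ b
  walk-stays-below _ _ (here _) si≼a = si≼a
  walk-stays-below {S} pi≡x ¬Sx (step _ (j , inj₁ (refl , refl)) walk) ≼-refl =
    ⊥-elim (¬Sx (subst S pi≡x (walk-start walk)))
  walk-stays-below pi≡x ¬Sx (step _ (j , inj₁ (refl , refl)) walk) (≼-child si≼a') =
    walk-stays-below pi≡x ¬Sx walk si≼a'
  walk-stays-below pi≡x ¬Sx (step _ (j , inj₂ (refl , refl)) walk) si≼a =
    walk-stays-below pi≡x ¬Sx walk (≼-child si≼a)

-- Tree decompositions of the complement of J(n,k)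

module _ {n k : ℕ} (D : TreeDecomposition (JohnsonBar n k)) where

  open TreeDecomposition D
  open JohnsonComplement n k
  open JohnsonComplement.Piece
  open RootedTree tree
  open DecMembership _≟ᵥ_ using (_∈?_)

  BagsBelow : Node → List V → Set
  BagsBelow c P = ∀ {p} → p ∈ P → ∀ z → p ∈ bag z → c ≼ z

  BagsNotBelow : Node → List V → Set
  BagsNotBelow x P = ∀ {p} → p ∈ P → ∀ z → p ∈ bag z → ¬ x ≼ z

  Branch : Node → List V → Set
  Branch x P = (∃ λ i → parent i ≡ x × BagsBelow (fsuc i) P) ⊎ BagsNotBelow x P

  spread-below : ∀ {v x i z₀} → parent i ≡ x → v ∉ bag x → v ∈ bag z₀ → fsuc i ≼ z₀ →
                 ∀ z → v ∈ bag z → fsuc i ≼ z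
  spread-below {v} {z₀ = z₀} pi≡x v∉x v∈z₀ si≼z₀ z v∈z =
    walk-stays-below pi≡x v∉x (connected v z₀ z v∈z₀ v∈z) si≼z₀

  spread-not-below : ∀ {v x z₀} → v ∉ bag x → v ∈ bag z₀ → ¬ x ≼ z₀ → ∀ z → v ∈ bag z → ¬ x ≼ z
  spread-not-below {v} {z₀ = z₀} v∉x v∈z₀ x⋠z₀ z v∈z = walk-stays-outside v∉x (connected v z₀ z v∈z₀ v∈z) x⋠z₀

  vertex-branch : ∀ {x v} → v ∉ bag x → Branch x (v ∷ [])
  vertex-branch {x} {v} v∉x with covers v
  ... | z₀ , v∈z₀ with x ≼? z₀
  ... | no x⋠z₀ = inj₂ λ { (here refl) → spread-not-below v∉x v∈z₀ x⋠z₀ }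
  ... | yes x≼z₀ with ≼-via-child x≼z₀ (λ { refl → v∉x v∈z₀ })
  ... | i , pi≡x , si≼z₀ = inj₁ (i , pi≡x , λ { (here refl) → spread-below pi≡x v∉x v∈z₀ si≼z₀ })

  branch : ∀ {x P} → Connected P → (∀ {p} → p ∈ P → p ∉ bag x) → Branch x P
  branch (single v) P∩x=∅ = vertex-branch (P∩x=∅ (here refl))
  branch {x} (extend {v} {w} w∈P vw conn) P∩x=∅ with branch conn (λ p∈P → P∩x=∅ (there p∈P)) | edgeCover v w vw
  ... | inj₁ (i , pi≡x , below) | e , v∈e , w∈e = inj₁ (i , pi≡x , λ
    { (here refl) → spread-below pi≡x (P∩x=∅ (here refl)) v∈e (below w∈P e w∈e)
    ; (there p∈P) → below p∈P })
  ... | inj₂ not-below | e , v∈e , w∈e = inj₂ λ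
    { (here refl) → spread-not-below (P∩x=∅ (here refl)) v∈e (not-below w∈P e w∈e)
    ; (there p∈P) → not-below p∈P }

  Below⇒¬NotBelow : ∀ {c P} → Connected P → BagsBelow c P → ¬ BagsNotBelow c P
  Below⇒¬NotBelow (single v) below not-below =
    not-below (here refl) _ (proj₂ (covers v)) (below (here refl) _ (proj₂ (covers v)))
  Below⇒¬NotBelow (extend {v} _ _ _) below not-below =
    not-below (here refl) _ (proj₂ (covers v)) (below (here refl) _ (proj₂ (covers v)))

  outsideBag : Node → List V
  outsideBag x = filter (∁? (_∈? bag x)) (subsetsOfSize n k)

  outsideBag-unique : ∀ x → Unique (outsideBag x)
  outsideBag-unique x = Unique.filter⁺ (∁? (_∈? bag x)) (subsetsOfSize-unique n k)

  outsideBag∌bag : ∀ {x v} → v ∈ outsideBag x → v ∉ bag x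
  outsideBag∌bag {x} v∈ = proj₂ (∈-filter⁻ (∁? (_∈? bag x)) {xs = subsetsOfSize n k} v∈)

  nCk+k≤bag+ : ∀ x {a} → length (outsideBag x) + k ≤ a → n C k + k ≤ length (bag x) + a
  nCk+k≤bag+ x {a} outside+k≤a = begin
    n C k + k
      ≡⟨ cong (_+ k) (length-subsetsOfSize n k) ⟨
    length all + k
      ≡⟨ cong (_+ k) (length-filter+filter-∁ (_∈? bag x) all) ⟨
    length (filter (_∈? bag x) all) + length (outsideBag x) + k
      ≤⟨ +-monoˡ-≤ k (+-monoˡ-≤ (length (outsideBag x)) inBag≤bag) ⟩
    length (bag x) + length (outsideBag x) + k
      ≡⟨ +-assoc (length (bag x)) _ k ⟩
    length (bag x) + (length (outsideBag x) + k)
      ≤⟨ +-monoʳ-≤ (length (bag x)) outside+k≤a ⟩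
    length (bag x) + a
      ∎
    where
    open ≤-Reasoning
    all = subsetsOfSize n k
    inBag≤bag : length (filter (_∈? bag x) all) ≤ length (bag x)
    inBag≤bag = unique⊆⇒length≤ (Unique.filter⁺ (_∈? bag x) (subsetsOfSize-unique n k))
                                (λ v∈ → proj₂ (∈-filter⁻ (_∈? bag x) {xs = all} v∈))

  Sealed : Node → Set
  Sealed x = ∀ {P} → Connected P → Unique P → 2 ≤ length P → ¬ BagsNotBelow x P

  root-sealed : Sealed fzero
  root-sealed conn _ _ not-below = Below⇒¬NotBelow conn (λ _ z _ → root≼ z) not-below

  sealed-by : ∀ {c F} → Unique F → Connected F → 5 ≤ length F → BagsBelow c F → Sealed c
  sealed-by {c} {F} uF _ 5≤∣F∣ below {P} connP uP 2≤∣P∣ not-below with Connected⇒HasEdge connP 2≤∣P∣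
  ... | u , u' , u∈P , u'∈P , uu' = 1+n≰n (≤-trans (+-mono-≤ 2≤∣P∣ 5≤∣F∣)
          (∼-bipartite-bound₃ uP uF P∼F {u} {u'} u∈P u'∈P uu' (≤-trans (s≤s (s≤s (s≤s z≤n))) 5≤∣F∣)))
    where
    P∼F : ∀ {p f} → p ∈ P → f ∈ F → p ∼ f
    P∼F {p} {f} p∈P f∈F = ¬Adj⇒∼ p≢f ¬pf
      where
      p≢f : p ≢ f
      p≢f refl = not-below p∈P _ (proj₂ (covers p)) (below f∈F _ (proj₂ (covers p)))
      ¬pf : ¬ Adj p f
      ¬pf pf with edgeCover p f pf
      ... | e , p∈e , f∈e = not-below p∈P e p∈e (below f∈F e f∈e)

  descend : ∀ {x i} f → parent i ≡ x → m ≤ toℕ x + f → ∃ λ f′ → f ≡ suc f′ × m ≤ toℕ (fsuc i) + f′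
  descend {x} zero pi≡x m≤x+0 = ⊥-elim (1+n≰n (≤-trans (proj₁ (child-index pi≡x))
    (≤-trans (proj₂ (child-index pi≡x)) (subst (m ≤_) (+-identityʳ (toℕ x)) m≤x+0))))
  descend {x} (suc f) pi≡x m≤x+1+f = f , refl ,
    ≤-trans m≤x+1+f (≤-trans (≤-reflexive (+-suc (toℕ x) f)) (+-monoˡ-≤ f (proj₁ (child-index pi≡x))))

  in-child-bag : ∀ {x i w P} → parent i ≡ x → w ∈ bag x → BagsBelow (fsuc i) P →
                 (∃ λ p → p ∈ P × Adj w p) → w ∈ bag (fsuc i)
  in-child-bag {x} {w = w} pi≡x w∈x below (p , p∈P , wp) with edgeCover w p wp
  ... | e , w∈e , p∈e = walk-enters-through (connected w x e w∈x w∈e) (child-⋠-parent pi≡x) (below p∈P e p∈e)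

  larger-bag-below : ∀ f {B P c} → m ≤ toℕ c + f → Unique B → (∀ {w} → w ∈ B → w ∈ bag c) →
                     Connected P → (∀ {p} → p ∈ P → p ∉ B) → BagsBelow c P →
                     (∀ {w} → w ∈ B → ∃ λ p → p ∈ P × Adj w p) → ∃ λ z → suc (length B) ≤ length (bag z)
  larger-bag-below f {B} {P} {c} fuel uB B⊆c connP P∩B=∅ below dominated with any? (_∈? bag c) P
  ... | yes some with find some
  ... | p , p∈P , p∈c =
    c , unique⊆⇒length≤ (unique-∷ (P∩B=∅ p∈P) uB) λ { (here refl) → p∈c ; (there w∈B) → B⊆c w∈B }
  larger-bag-below f {B} {P} {c} fuel uB B⊆c connP P∩B=∅ below dominated | no none
    with branch connP (λ p∈P p∈c → none (lose p∈P p∈c))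
  ... | inj₂ not-below = ⊥-elim (Below⇒¬NotBelow connP below not-below)
  ... | inj₁ (i , pi≡c , below′) with descend f pi≡c fuel
  ... | f′ , refl , fuel′ = larger-bag-below f′ fuel′ uB
          (λ w∈B → in-child-bag pi≡c (B⊆c w∈B) below′ (dominated w∈B)) connP P∩B=∅ below′ dominated

  Good : Node → Set
  Good z = n C k + k ≤ length (bag z) + (n + 1)

  good-node-from-dominating : ∀ f {x} → m ≤ toℕ x + f → Sealed x → DominatingPiece (outsideBag x) → ∃ Good
  good-node-from-dominating f {x} fuel sealed
    record { piece = P ; edge = edge ; dominates = dominates ; small = small }
    with branch (vertices-connected P) (λ p∈P → outsideBag∌bag (vertices⊆W P p∈P))
  ... | inj₂ not-below =
    ⊥-elim (sealed (vertices-connected P) (vertices-unique P) (HasEdge⇒2≤length edge) not-below)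
  ... | inj₁ (i , pi≡x , below) with descend f pi≡x fuel
  ... | f′ , refl , fuel′ with larger-bag-below f′ fuel′ (bagUnique x)
         (λ w∈x → in-child-bag pi≡x w∈x below (dominated w∈x)) (vertices-connected P)
         (λ p∈P p∈x → outsideBag∌bag (vertices⊆W P p∈P) p∈x) below dominated
    where
    dominated : ∀ {w} → w ∈ bag x → ∃ λ p → p ∈ vertices P × Adj w p
    dominated w∈x = dominates λ w∈W → outsideBag∌bag w∈W w∈x
  ... | z , 1+bag≤z = z , (begin
    n C k + k                      ≤⟨ nCk+k≤bag+ x small ⟩
    length (bag x) + (n + 2)       ≡⟨ cong (length (bag x) +_) (+-suc n 1) ⟩
    length (bag x) + suc (n + 1)   ≡⟨ +-suc (length (bag x)) (n + 1) ⟩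
    suc (length (bag x)) + (n + 1) ≤⟨ +-monoˡ-≤ (n + 1) 1+bag≤z ⟩
    length (bag z) + (n + 1)       ∎)
    where open ≤-Reasoning

  good-node : k + 4 ≤ n → k + k ≤ n → ∀ f x → m ≤ toℕ x + f → Sealed x → ∃ Good
  good-node k+4≤n 2k≤n f x fuel sealed with trichotomy (outsideBag-unique x) k+4≤n 2k≤n
  ... | inj₁ outside+k≤n+1 = x , nCk+k≤bag+ x outside+k≤n+1
  ... | inj₂ (inj₂ dom) = good-node-from-dominating f fuel sealed dom
  ... | inj₂ (inj₁ (F , 5≤∣F∣)) with branch (vertices-connected F) (λ p∈F → outsideBag∌bag (vertices⊆W F p∈F))
  ... | inj₂ not-below =
    ⊥-elim (sealed (vertices-connected F) (vertices-unique F) (≤-trans (s≤s (s≤s z≤n)) 5≤∣F∣) not-below)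
  ... | inj₁ (i , pi≡x , below) with descend f pi≡x fuel
  ... | f′ , refl , fuel′ = good-node k+4≤n 2k≤n f′ (fsuc i) fuel′
                              (sealed-by (vertices-unique F) (vertices-connected F) 5≤∣F∣ below)

  good-node-exists : k + 4 ≤ n → k + k ≤ n → ∃ Good
  good-node-exists k+4≤n 2k≤n = good-node k+4≤n 2k≤n m fzero ≤-refl root-sealed

  bag≤maxBagSize : ∀ z → length (bag z) ≤ maxBagSize
  bag≤maxBagSize z = ∈⇒≤foldr-⊔ (λ x → length (bag x)) (∈-allFin z)

width-bound : ∀ {N n k b M} → N + k ≤ b + (n + 1) → n ≤ N → b ≤ M → N ∸ n + k ∸ 2 ≤ M ∸ 1
width-bound {N} {n} {k} {b} {M} N+k≤b+n+1 n≤N b≤M =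
  ≤-trans (∸-monoˡ-≤ 2 N∸n+k≤b+1) (≤-trans (≤-reflexive (cong (_∸ 2) (+-comm b 1))) (∸-monoˡ-≤ 1 b≤M))
  where
  open ≤-Reasoning
  N∸n+k≤b+1 : N ∸ n + k ≤ b + 1
  N∸n+k≤b+1 = +-cancelʳ-≤ n _ _ (begin
    N ∸ n + k + n ≡⟨ +-shuffle (N ∸ n) k n ⟩
    N ∸ n + n + k ≡⟨ cong (_+ k) (m∸n+n≡m n≤N) ⟩
    N + k         ≤⟨ N+k≤b+n+1 ⟩
    b + (n + 1)   ≡⟨ +-shuffle′ b n 1 ⟩
    b + 1 + n     ∎)
    where
    +-shuffle : ∀ a k n → a + k + n ≡ a + n + k
    +-shuffle = solve-∀
    +-shuffle′ : ∀ b n c → b + (n + c) ≡ b + c + n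
    +-shuffle′ = solve-∀

lemma4p2 : (n k : ℕ) → 2 ≤ k → ((k + 4) ⊔ (2 * k)) ≤ n → twAtLeast (JohnsonBar n k) (((n C k) ∸ n) + k ∸ 2)
lemma4p2 n k 2≤k k+4⊔2k≤n D =
  let z , good = good-node-exists D k+4≤n 2k≤n
  in width-bound good (n≤nCk (≤-trans (s≤s z≤n) 2≤k) (≤-trans (m<m+n k (s≤s z≤n)) k+4≤n)) (bag≤maxBagSize D z)
  where
  k+4≤n : k + 4 ≤ n
  k+4≤n = ≤-trans (m≤m⊔n (k + 4) (2 * k)) k+4⊔2k≤n
  2k≤n : k + k ≤ n
  2k≤n = ≤-trans (≤-reflexive (cong (k +_) (sym (+-identityʳ k)))) (≤-trans (m≤n⊔m (k + 4) (2 * k)) k+4⊔2k≤n)
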